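{- Let $f:\{0,1\}^n\to\{0,1\}$ be a Boolean function. Then $\mathsf{D}^{\rightarrow}_{\mathrm{cc}}(f\circ\mathsf{AND})=\lceil\log(\mathsf{Pat}^{\mathsf{M}}(f))\rceil$.
   Context: Every $f:\{0,1\}^n\to\{0,1\}$ has a unique expansion $f=\sum_{S\subseteq[n]}\widetilde f(S)\mathsf{AND}_S$ with real coefficients, where $\mathsf{AND}_S(x)=\prod_{i\in S}x_i$ (the Möbius expansion); its Möbius support is $\mathcal{S}_f=\{S:\widetilde f(S)\neq0\}$. The pattern of $x\in\{0,1\}^n$ is the vector $(\mathsf{AND}_S(x))_{S\in\mathcal{S}_f}\in\{0,1\}^{\mathcal{S}_f}$, and the Möbius pattern complexity $\mathsf{Pat}^{\mathsf{M}}(f)$ is the number of distinct patterns over all $x\in\{0,1\}^n$. $f\circ\mathsf{AND}$ is the two-party function $(x,y)\mapsto f(x_1\wedge y_1,\dots,x_n\wedge y_n)$, Alice holding $x$, Bob $y$. $\mathsf{D}^{\rightarrow}_{\mathrm{cc}}$ is deterministic one-way communication complexity (Alice sends one message, Bob outputs; cost is maximum message length in bits). Logarithms base 2. -}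

module Defs where

open import Data.Bool using (Bool; true; false; _∧_; if_then_else_)
import Data.Bool.Properties as BoolP
open import Data.Nat using (ℕ; zero; suc; _≤_)
open import Data.Nat.Logarithm using (⌈log₂_⌉)
open import Data.Integer using (ℤ; _+_; _*_; 0ℤ; 1ℤ)
import Data.Integer as ℤ
open import Data.List using (List; []; _∷_; map; _++_; length; filter; deduplicate; foldr)
import Data.List.Properties as ListP
open import Data.Vec using (Vec; []; _∷_; zipWith)
open import Data.Product using (_×_; Σ)
open import Relation.Nullary using (¬?)
open import Relation.Binary.PropositionalEquality using (_≡_)

-- Points of {0,1}^n; subsets S ⊆ [n] are encoded as characteristic vectors.
BoolFn : ℕ → Set
BoolFn n = Vec Bool n → Bool

Subset : ℕ → Set
Subset n = Vec Bool n

allVecs : (n : ℕ) → List (Vec Bool n)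
allVecs zero = [] ∷ []
allVecs (suc n) = map (false ∷_) (allVecs n) ++ map (true ∷_) (allVecs n)

AND : ∀ {n} → Subset n → Vec Bool n → Bool
AND [] [] = true
AND (false ∷ S) (_ ∷ x) = AND S x
AND (true ∷ S) (xi ∷ x) = xi ∧ AND S x

toℤ : Bool → ℤ
toℤ b = if b then 1ℤ else 0ℤ

sumℤ : List ℤ → ℤ
sumℤ = foldr _+_ 0ℤ

-- c is the Möbius expansion of f: f = Σ_S c(S) AND_S (pointwise as numbers).
-- (The expansion is unique; its coefficients are integers.)
IsMobiusExpansion : ∀ {n} → BoolFn n → (Subset n → ℤ) → Set
IsMobiusExpansion {n} f c =
  ∀ x → toℤ (f x) ≡ sumℤ (map (λ S → c S * toℤ (AND S x)) (allVecs n))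

support : ∀ {n} → (Subset n → ℤ) → List (Subset n)
support {n} c = filter (λ S → ¬? (c S ℤ.≟ 0ℤ)) (allVecs n)

patternOf : ∀ {n} → (Subset n → ℤ) → Vec Bool n → List Bool
patternOf c x = map (λ S → AND S x) (support c)

PatM : ∀ {n} → (Subset n → ℤ) → ℕ
PatM {n} c = length (deduplicate (ListP.≡-dec BoolP._≟_) (map (patternOf c) (allVecs n)))

_∘AND : ∀ {n} → BoolFn n → Vec Bool n → Vec Bool n → Bool
(f ∘AND) x y = f (zipWith _∧_ x y)

OneWayProtocol : ∀ {n} → (Vec Bool n → Vec Bool n → Bool) → ℕ → Set
OneWayProtocol {n} F k =
  Σ (Vec Bool n → Vec Bool k) λ A →
  Σ (Vec Bool k → Vec Bool n → Bool) λ B →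
  ∀ x y → B (A x) y ≡ F x y

OneWayCC : ∀ {n} → (Vec Bool n → Vec Bool n → Bool) → ℕ → Set
OneWayCC F d = OneWayProtocol F d × (∀ k → OneWayProtocol F k → d ≤ k)

-- Since the Möbius expansion is unique, the row y ↦ f (x ∧ y) of the communication matrix
-- has the Möbius coefficients c(S) · AND_S(x).  These are determined by the pattern of x
-- (c(S) = 0 off the support), and determine it (c(S) ≠ 0 on the support).  So two inputs
-- of Alice give the same row iff they have the same pattern, and a one-way protocol is
-- exactly an encoding of the Pat^M(f) row classes into messages: it has cost k iff
-- Pat^M(f) ≤ 2^k, and the least such k is ⌈log₂ Pat^M(f)⌉.
module Submission where

open import Defs
open import Data.Bool using (Bool; true; false; _∧_)
import Data.Bool.Properties as BoolP
open import Data.Nat as ℕ using (ℕ; zero; suc; _≤_; _<_; _^_; z≤n; s≤s)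
import Data.Nat.Properties as ℕP
open import Data.Nat.Induction using (<-wellFounded)
open import Data.Nat.Logarithm using (⌈log₂_⌉; ⌈log₂⌉-mono-≤; ⌈log₂2^n⌉≡n)
open import Data.Nat.Logarithm.Core using (⌈log2⌉)
open import Data.Integer using (ℤ; _+_; _*_; 0ℤ; ≢-nonZero)
import Data.Integer.Properties as ℤP
open import Algebra.Bundles using (AbelianGroup)
open import Algebra.Properties.Group (AbelianGroup.group ℤP.+-0-abelianGroup) using (∙-cancelˡ)
open import Data.List using (List; []; _∷_; map; _++_; length; deduplicate; lookup)
import Data.List.Properties as ListP
open import Data.List.Relation.Unary.Any as Any using (here; there; any?)
open import Data.List.Relation.Unary.Any.Properties using (lookup-index)
import Data.List.Relation.Unary.All as All
open import Data.List.Relation.Unary.Unique.Propositional using (Unique)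
open import Data.List.Relation.Unary.Unique.DecPropositional.Properties using (deduplicate-!)
open import Data.List.Relation.Unary.AllPairs using (_∷_)
open import Data.List.Membership.Propositional using (_∈_)
open import Data.List.Membership.Propositional.Properties
  using ( ∈-map⁺; ∈-map⁻; ∈-++⁺ˡ; ∈-++⁺ʳ; ∈-filter⁺; ∈-filter⁻
        ; ∈-deduplicate⁺; ∈-deduplicate⁻; ∈-lookup)
open import Data.Vec using (Vec; []; _∷_; zipWith; replicate)
import Data.Vec.Properties as VecP
open import Data.Fin using (Fin; inject≤)
open import Data.Fin.Properties using (2↔Bool; *↔×; inject≤-injective; injective⇒≤)
open import Data.Product using (_×_; _,_; proj₁; proj₂; ∃)
open import Data.Product.Function.NonDependent.Propositional using (_×-↔_)
open import Function using (_∘_; _⇔_; mk⇔; Equivalence; Injection; Inverse; _↔_; mk↔ₛ′)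
open import Function.Construct.Composition using (_⇔-∘_)
open import Function.Construct.Symmetry using (⇔-sym)
open import Function.Properties.Inverse using (↔-sym; ↔-trans; ↔⇒↣)
open import Induction.WellFounded using (Acc; acc)
open import Relation.Binary.Definitions using (DecidableEquality)
open import Relation.Nullary using (yes; no; ¬?)
open import Data.Empty using (⊥-elim)
open import Relation.Binary.PropositionalEquality

sumCube : ∀ n → (Vec Bool n → ℤ) → ℤ
sumCube zero g = g []
sumCube (suc n) g = sumCube n (g ∘ (false ∷_)) + sumCube n (g ∘ (true ∷_))

sumℤ-++ : ∀ xs ys → sumℤ (xs ++ ys) ≡ sumℤ xs + sumℤ ys
sumℤ-++ [] ys = sym (ℤP.+-identityˡ _)
sumℤ-++ (x ∷ xs) ys = trans (cong (x +_) (sumℤ-++ xs ys)) (sym (ℤP.+-assoc x _ _))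

sumℤ-map-allVecs : ∀ n (g : Vec Bool n → ℤ) → sumℤ (map g (allVecs n)) ≡ sumCube n g
sumℤ-map-allVecs zero g = ℤP.+-identityʳ (g [])
sumℤ-map-allVecs (suc n) g = begin
  sumℤ (map g (map (false ∷_) L ++ map (true ∷_) L))
    ≡⟨ cong sumℤ (ListP.map-++ g (map (false ∷_) L) _) ⟩
  sumℤ (map g (map (false ∷_) L) ++ map g (map (true ∷_) L))
    ≡⟨ sumℤ-++ (map g (map (false ∷_) L)) _ ⟩
  sumℤ (map g (map (false ∷_) L)) + sumℤ (map g (map (true ∷_) L))
    ≡⟨ cong₂ _+_ (cong sumℤ (sym (ListP.map-∘ L))) (cong sumℤ (sym (ListP.map-∘ L))) ⟩
  sumℤ (map (g ∘ (false ∷_)) L) + sumℤ (map (g ∘ (true ∷_)) L)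
    ≡⟨ cong₂ _+_ (sumℤ-map-allVecs n _) (sumℤ-map-allVecs n _) ⟩
  sumCube (suc n) g ∎
  where
  open ≡-Reasoning
  L = allVecs n

sumCube-cong : ∀ n {g h : Vec Bool n → ℤ} → g ≗ h → sumCube n g ≡ sumCube n h
sumCube-cong zero g≗h = g≗h []
sumCube-cong (suc n) g≗h =
  cong₂ _+_ (sumCube-cong n (g≗h ∘ (false ∷_))) (sumCube-cong n (g≗h ∘ (true ∷_)))

sumCube-zero : ∀ n → sumCube n (λ _ → 0ℤ) ≡ 0ℤ
sumCube-zero zero = refl
sumCube-zero (suc n) = cong₂ _+_ (sumCube-zero n) (sumCube-zero n)

∈-allVecs : ∀ {n} (x : Vec Bool n) → x ∈ allVecs n
∈-allVecs [] = here refl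
∈-allVecs {suc n} (false ∷ x) = ∈-++⁺ˡ (∈-map⁺ (false ∷_) (∈-allVecs x))
∈-allVecs {suc n} (true ∷ x) =
  ∈-++⁺ʳ (map (false ∷_) (allVecs n)) (∈-map⁺ (true ∷_) (∈-allVecs x))

expansion : ∀ {n} → (Subset n → ℤ) → Vec Bool n → ℤ
expansion {n} a y = sumCube n (λ S → a S * toℤ (AND S y))

expansion-cong : ∀ {n} {a b : Subset n → ℤ} → a ≗ b → expansion a ≗ expansion b
expansion-cong {n} a≗b y = sumCube-cong n (λ S → cong (_* toℤ (AND S y)) (a≗b S))

expansion-false∷ : ∀ {n} (a : Subset (suc n) → ℤ) y →
                   expansion a (false ∷ y) ≡ expansion (a ∘ (false ∷_)) y
expansion-false∷ {n} a y = begin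
  expansion (a ∘ (false ∷_)) y + sumCube n (λ S → a (true ∷ S) * 0ℤ)
    ≡⟨ cong (expansion (a ∘ (false ∷_)) y +_) (sumCube-cong n (ℤP.*-zeroʳ ∘ a ∘ (true ∷_))) ⟩
  expansion (a ∘ (false ∷_)) y + sumCube n (λ _ → 0ℤ)
    ≡⟨ cong (expansion (a ∘ (false ∷_)) y +_) (sumCube-zero n) ⟩
  expansion (a ∘ (false ∷_)) y + 0ℤ
    ≡⟨ ℤP.+-identityʳ _ ⟩
  expansion (a ∘ (false ∷_)) y ∎
  where open ≡-Reasoning

-- Setting the first input bit to 0 isolates the coefficients of sets avoiding 1; setting it
-- to 1 then adds those of the sets containing 1, which are recovered by cancellation.
expansion-injective : ∀ n {a b : Subset n → ℤ} → expansion a ≗ expansion b → a ≗ b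
expansion-injective zero {a} {b} eq [] =
  trans (sym (ℤP.*-identityʳ (a []))) (trans (eq []) (ℤP.*-identityʳ (b [])))
expansion-injective (suc n) {a} {b} eq = λ where
    (false ∷ S) → same₀ S
    (true ∷ S) → same₁ S
  where
  same₀ : a ∘ (false ∷_) ≗ b ∘ (false ∷_)
  same₀ = expansion-injective n λ y →
    trans (sym (expansion-false∷ a y)) (trans (eq (false ∷ y)) (expansion-false∷ b y))
  same₁ : a ∘ (true ∷_) ≗ b ∘ (true ∷_)
  same₁ = expansion-injective n λ y → ∙-cancelˡ (expansion (a ∘ (false ∷_)) y) _ _
    (trans (eq (true ∷ y))
      (cong (_+ expansion (b ∘ (true ∷_)) y) (expansion-cong (sym ∘ same₀) y)))

toℤ-∧ : ∀ a b → toℤ (a ∧ b) ≡ toℤ a * toℤ b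
toℤ-∧ false b = refl
toℤ-∧ true false = refl
toℤ-∧ true true = refl

toℤ-injective : ∀ {a b} → toℤ a ≡ toℤ b → a ≡ b
toℤ-injective {false} {false} _ = refl
toℤ-injective {true} {true} _ = refl

AND-zipWith-∧ : ∀ {n} (S x y : Vec Bool n) → AND S (zipWith _∧_ x y) ≡ AND S x ∧ AND S y
AND-zipWith-∧ [] [] [] = refl
AND-zipWith-∧ (false ∷ S) (_ ∷ x) (_ ∷ y) = AND-zipWith-∧ S x y
AND-zipWith-∧ (true ∷ S) (false ∷ x) (_ ∷ y) = refl
AND-zipWith-∧ (true ∷ S) (true ∷ x) (false ∷ y) = sym (BoolP.∧-zeroʳ (AND S x))
AND-zipWith-∧ (true ∷ S) (true ∷ x) (true ∷ y) = AND-zipWith-∧ S x y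

rowCoefficients : ∀ {n} → (Subset n → ℤ) → Vec Bool n → Subset n → ℤ
rowCoefficients c x S = c S * toℤ (AND S x)

SameRow : ∀ {n} → (Vec Bool n → Vec Bool n → Bool) → Vec Bool n → Vec Bool n → Set
SameRow F x x' = ∀ y → F x y ≡ F x' y

map-≡⇒≡-∈ : ∀ {A B : Set} {f g : A → B} {xs : List A} {a : A} →
            map f xs ≡ map g xs → a ∈ xs → f a ≡ g a
map-≡⇒≡-∈ {xs = _ ∷ _} eq (here refl) = proj₁ (ListP.∷-injective eq)
map-≡⇒≡-∈ {xs = _ ∷ _} eq (there a∈xs) = map-≡⇒≡-∈ (proj₂ (ListP.∷-injective eq)) a∈xs

samePattern⇔sameRowCoefficients : ∀ {n} (c : Subset n → ℤ) x x' →
  patternOf c x ≡ patternOf c x' ⇔ (rowCoefficients c x ≗ rowCoefficients c x')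
samePattern⇔sameRowCoefficients {n} c x x' = mk⇔ to from
  where
  nonzero? = λ S → ¬? (c S ℤP.≟ 0ℤ)
  to : patternOf c x ≡ patternOf c x' → rowCoefficients c x ≗ rowCoefficients c x'
  to same S with c S ℤP.≟ 0ℤ
  ... | yes cS≡0 rewrite cS≡0 = refl
  ... | no cS≢0 = cong (λ b → c S * toℤ b)
          (map-≡⇒≡-∈ same (∈-filter⁺ nonzero? (∈-allVecs S) cS≢0))
  from : rowCoefficients c x ≗ rowCoefficients c x' → patternOf c x ≡ patternOf c x'
  from same = ListP.map-cong-local (All.tabulate λ {S} S∈support →
    let cS≢0 = proj₂ (∈-filter⁻ nonzero? {xs = allVecs n} S∈support) in
    toℤ-injective (ℤP.*-cancelˡ-≡ (c S) _ _ {{≢-nonZero cS≢0}} (same S)))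

module _ {n} {f : BoolFn n} {c : Subset n → ℤ} (mobius : IsMobiusExpansion f c) where

  row-expansion : ∀ x y → toℤ ((f ∘AND) x y) ≡ expansion (rowCoefficients c x) y
  row-expansion x y = begin
    toℤ (f (zipWith _∧_ x y))
      ≡⟨ mobius (zipWith _∧_ x y) ⟩
    sumℤ (map (λ S → c S * toℤ (AND S (zipWith _∧_ x y))) (allVecs n))
      ≡⟨ sumℤ-map-allVecs n _ ⟩
    sumCube n (λ S → c S * toℤ (AND S (zipWith _∧_ x y)))
      ≡⟨ sumCube-cong n (λ S → cong (c S *_)
           (trans (cong toℤ (AND-zipWith-∧ S x y)) (toℤ-∧ (AND S x) (AND S y)))) ⟩
    sumCube n (λ S → c S * (toℤ (AND S x) * toℤ (AND S y)))
      ≡⟨ sumCube-cong n (λ S → sym (ℤP.*-assoc (c S) _ _)) ⟩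
    expansion (rowCoefficients c x) y ∎
    where open ≡-Reasoning

  sameRow⇔sameRowCoefficients : ∀ x x' →
    SameRow (f ∘AND) x x' ⇔ (rowCoefficients c x ≗ rowCoefficients c x')
  sameRow⇔sameRowCoefficients x x' = mk⇔
    (λ same → expansion-injective n λ y →
      trans (sym (row-expansion x y)) (trans (cong toℤ (same y)) (row-expansion x' y)))
    (λ same y → toℤ-injective
      (trans (row-expansion x y) (trans (expansion-cong same y) (sym (row-expansion x' y)))))

  samePattern⇔sameRow : ∀ x x' → patternOf c x ≡ patternOf c x' ⇔ SameRow (f ∘AND) x x'
  samePattern⇔sameRow x x' =
    ⇔-sym (sameRow⇔sameRowCoefficients x x') ⇔-∘ samePattern⇔sameRowCoefficients c x x'

bits↔Fin : ∀ k → Vec Bool k ↔ Fin (2 ^ k)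
bits↔Fin zero =
  mk↔ₛ′ (λ _ → Fin.zero) (λ _ → []) (λ { Fin.zero → refl ; (Fin.suc ()) }) (λ { [] → refl })
bits↔Fin (suc k) = ↔-trans uncons↔ (↔-trans (↔-sym 2↔Bool ×-↔ bits↔Fin k) (↔-sym *↔×))
  where
  uncons↔ : Vec Bool (suc k) ↔ (Bool × Vec Bool k)
  uncons↔ = mk↔ₛ′ (λ { (b ∷ v) → b , v }) (λ (b , v) → b ∷ v) (λ _ → refl) (λ { (_ ∷ _) → refl })

n≤2^⌈log₂n⌉ : ∀ n → n ≤ 2 ^ ⌈log₂ n ⌉
n≤2^⌈log₂n⌉ n = bound n (<-wellFounded n)
  where
  bound : ∀ m (rec : Acc _<_ m) → m ≤ 2 ^ ⌈log2⌉ m rec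
  bound 0 _ = z≤n
  bound 1 _ = s≤s z≤n
  bound (suc (suc m)) (acc rs) = begin
    2 ℕ.+ m                 ≤⟨ ℕP.+-monoʳ-≤ 2 m≤2h ⟩
    2 ℕ.+ 2 ℕ.* h           ≡⟨ sym (ℕP.*-suc 2 h) ⟩
    2 ℕ.* suc h             ≤⟨ ℕP.*-monoʳ-≤ 2 (bound (suc h) _) ⟩
    2 ℕ.* 2 ^ ⌈log2⌉ (suc h) _ ∎
    where
    open ℕP.≤-Reasoning
    h = ℕ.⌈ m /2⌉
    m≤2h : m ≤ 2 ℕ.* h
    m≤2h = begin
      m               ≡⟨ sym (ℕP.⌊n/2⌋+⌈n/2⌉≡n m) ⟩
      ℕ.⌊ m /2⌋ ℕ.+ h ≤⟨ ℕP.+-monoˡ-≤ h (ℕP.⌊n/2⌋≤⌈n/2⌉ m) ⟩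
      h ℕ.+ h         ≡⟨ cong (h ℕ.+_) (sym (ℕP.+-identityʳ h)) ⟩
      2 ℕ.* h         ∎

⌈log₂⌉-least : ∀ n k → n ≤ 2 ^ k → ⌈log₂ n ⌉ ≤ k
⌈log₂⌉-least n k n≤2^k = ℕP.≤-trans (⌈log₂⌉-mono-≤ n≤2^k) (ℕP.≤-reflexive (⌈log₂2^n⌉≡n k))

Unique⇒lookup-injective : ∀ {A : Set} {xs : List A} → Unique xs →
                          ∀ i j → lookup xs i ≡ lookup xs j → i ≡ j
Unique⇒lookup-injective {xs = _ ∷ _} _ Fin.zero Fin.zero _ = refl
Unique⇒lookup-injective {xs = _ ∷ xs} (x∉xs ∷ _) Fin.zero (Fin.suc j) eq =
  ⊥-elim (All.lookup x∉xs (∈-lookup {xs = xs} j) eq)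
Unique⇒lookup-injective {xs = _ ∷ xs} (x∉xs ∷ _) (Fin.suc i) Fin.zero eq =
  ⊥-elim (All.lookup x∉xs (∈-lookup {xs = xs} i) (sym eq))
Unique⇒lookup-injective {xs = _ ∷ _} (_ ∷ unique) (Fin.suc i) (Fin.suc j) eq =
  cong Fin.suc (Unique⇒lookup-injective unique i j eq)

module RowClasses {n} {C : Set} (_≟_ : DecidableEquality C)
                  (F : Vec Bool n → Vec Bool n → Bool) (cls : Vec Bool n → C)
                  (classifies : ∀ x x' → cls x ≡ cls x' ⇔ SameRow F x x') where

  classes : List C
  classes = deduplicate _≟_ (map cls (allVecs n))

  classCount : ℕ
  classCount = length classes

  cls∈classes : ∀ x → cls x ∈ classes
  cls∈classes x = ∈-deduplicate⁺ _≟_ (∈-map⁺ cls (∈-allVecs x))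

  classIndex : Vec Bool n → Fin classCount
  classIndex x = Any.index (cls∈classes x)

  lookup-classIndex : ∀ x → lookup classes (classIndex x) ≡ cls x
  lookup-classIndex x = sym (lookup-index (cls∈classes x))

  lookup-classes-injective : ∀ i j → lookup classes i ≡ lookup classes j → i ≡ j
  lookup-classes-injective = Unique⇒lookup-injective (deduplicate-! _≟_ (map cls (allVecs n)))

  classPreimage : ∀ i → ∃ λ x → x ∈ allVecs n × lookup classes i ≡ cls x
  classPreimage i = ∈-map⁻ cls (∈-deduplicate⁻ _≟_ (map cls (allVecs n)) (∈-lookup {xs = classes} i))

  representative : Fin classCount → Vec Bool n
  representative = proj₁ ∘ classPreimage

  cls-representative : ∀ i → cls (representative i) ≡ lookup classes i
  cls-representative i = sym (proj₂ (proj₂ (classPreimage i)))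

  module Decode {k} (message : Vec Bool n → Vec Bool k) where

    sender : Vec Bool k → Vec Bool n
    sender m with any? (λ x → VecP.≡-dec BoolP._≟_ (message x) m) (allVecs n)
    ... | yes found = proj₁ (Any.satisfied found)
    ... | no _ = replicate n false

    message-sender : ∀ x → message (sender (message x)) ≡ message x
    message-sender x with any? (λ x' → VecP.≡-dec BoolP._≟_ (message x') (message x)) (allVecs n)
    ... | yes found = proj₂ (Any.satisfied found)
    ... | no none = ⊥-elim (none (Any.map (λ x≡x' → cong message (sym x≡x')) (∈-allVecs x)))

  protocol : ∀ k → classCount ≤ 2 ^ k → OneWayProtocol F k
  protocol k count≤2^k = message , (λ m y → F (sender m) y) , correct
    where
    message : Vec Bool n → Vec Bool k
    message x = Inverse.from (bits↔Fin k) (inject≤ (classIndex x) count≤2^k)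
    open Decode message
    sameMessage⇒sameClass : ∀ x x' → message x ≡ message x' → cls x ≡ cls x'
    sameMessage⇒sameClass x x' eq = begin
      cls x                          ≡⟨ sym (lookup-classIndex x) ⟩
      lookup classes (classIndex x)  ≡⟨ cong (lookup classes) (inject≤-injective _ _ _ _
                                          (Injection.injective (↔⇒↣ (↔-sym (bits↔Fin k))) eq)) ⟩
      lookup classes (classIndex x') ≡⟨ lookup-classIndex x' ⟩
      cls x'                         ∎
      where open ≡-Reasoning
    correct : ∀ x y → F (sender (message x)) y ≡ F x y
    correct x = Equivalence.to (classifies _ x) (sameMessage⇒sameClass _ x (message-sender x))

  classCount≤2^cost : ∀ k → OneWayProtocol F k → classCount ≤ 2 ^ k
  classCount≤2^cost k (message , output , correct) = injective⇒≤ code-injective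
    where
    sameMessage⇒sameClass : ∀ x x' → message x ≡ message x' → cls x ≡ cls x'
    sameMessage⇒sameClass x x' eq = Equivalence.from (classifies x x') λ y →
      trans (sym (correct x y)) (trans (cong (λ m → output m y) eq) (correct x' y))
    code : Fin classCount → Fin (2 ^ k)
    code i = Inverse.to (bits↔Fin k) (message (representative i))
    code-injective : ∀ {i j} → code i ≡ code j → i ≡ j
    code-injective {i} {j} eq = lookup-classes-injective i j (begin
      lookup classes i         ≡⟨ sym (cls-representative i) ⟩
      cls (representative i)   ≡⟨ sameMessage⇒sameClass _ _ (Injection.injective (↔⇒↣ (bits↔Fin k)) eq) ⟩
      cls (representative j)   ≡⟨ cls-representative j ⟩
      lookup classes j         ∎)
      where open ≡-Reasoning

  oneWayCC : OneWayCC F ⌈log₂ classCount ⌉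
  oneWayCC = protocol _ (n≤2^⌈log₂n⌉ classCount)
           , λ k p → ⌈log₂⌉-least classCount k (classCount≤2^cost k p)

claim5 : (n : ℕ) (f : BoolFn n) (c : Subset n → ℤ) →
         IsMobiusExpansion f c →
         OneWayCC (f ∘AND) ⌈log₂ PatM c ⌉
claim5 n f c mobius =
  RowClasses.oneWayCC (ListP.≡-dec BoolP._≟_) (f ∘AND) (patternOf c) (samePattern⇔sameRow mobius)
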